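{- Fix $n$ and integers $a_0,a_1,\dots,a_h$ with $a_0=1$, $a_N\ge 1$ for $N=1,\dots,h$, and $a_0+a_1+\cdots+a_h=n$. Set $\mathcal{L}_0=\{1\}$ and $\mathcal{L}_N=[a_0+\cdots+a_{N-1}+1,\ a_0+\cdots+a_N]$ for $N=1,\dots,h$ (so $|\mathcal{L}_N|=a_N$). Then the number of graphs $G$ such that (1) $V(G)=[n]$, (2) $G$ is connected and the labeling $V(G)=[n]$ is closed, and (3) the $N$-th layer of $G$ is $\mathcal{L}_N$ for $N=0,\dots,h$, equals \[\prod_{N=0}^{h-1}\binom{a_{N+1}+a_N-1}{a_N-1}.\]
   Context: All graphs are finite and simple. For $i\le j$ in $[n]$, $[i,j]=\{k\in[n]: i\le k\le j\}$. A labeling $V(G)=[n]$ is closed if whenever $\{j,i\},\{i,k\}\in E(G)$ with $j\neq k$ and either $j>i<k$ or $j<i>k$, then $\{j,k\}\in E(G)$. For a connected graph with $V(G)=[n]$, the $N$-th layer is $L_N=\{i\in[n]: \text{the graph distance from } i \text{ to } 1 \text{ is } N\}$. -}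

module Defs where

open import Data.Nat using (ℕ; zero; suc; _+_; _*_; _∸_; _≤_; _<_)
open import Data.Nat.Combinatorics using (_C_)
open import Data.Fin using (Fin; toℕ)
import Data.Fin as F
open import Data.Vec using (Vec; lookup)
open import Data.Bool using (Bool; true)
open import Data.Product using (Σ; ∃; _×_)
open import Data.Sum using (_⊎_)
open import Data.Empty using (⊥)
open import Relation.Nullary using (¬_)
open import Relation.Binary.PropositionalEquality using (_≡_; _≢_)

-- A (candidate) graph on n vertices: adjacency matrix.
-- Vertex v : Fin n stands for the label toℕ v + 1 ∈ [n].
Graph : ℕ → Set
Graph n = Vec (Vec Bool n) n

Adj : ∀ {n} → Graph n → Fin n → Fin n → Set
Adj G i j = lookup (lookup G i) j ≡ true

IsSimple : ∀ {n} → Graph n → Set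
IsSimple G = (∀ i → ¬ Adj G i i) × (∀ i j → Adj G i j → Adj G j i)

data Walk {n} (G : Graph n) : Fin n → Fin n → ℕ → Set where
  here : ∀ {i} → Walk G i i 0
  step : ∀ {i j k m} → Adj G i j → Walk G j k m → Walk G i k (suc m)

Connected : ∀ {n} → Graph n → Set
Connected G = ∀ i j → ∃ λ m → Walk G i j m

Dist : ∀ {n} → Graph n → Fin n → Fin n → ℕ → Set
Dist G u v N = Walk G u v N × (∀ m → m < N → ¬ Walk G u v m)

Closed : ∀ {n} → Graph n → Set
Closed G = ∀ i j k → Adj G j i → Adj G i k → j ≢ k →
  ((i F.< j × i F.< k) ⊎ (j F.< i × k F.< i)) → Adj G j k

psum : (ℕ → ℕ) → ℕ → ℕ
psum a zero = a 0
psum a (suc N) = psum a N + a (suc N)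

InCalL : (ℕ → ℕ) → ℕ → ℕ → Set
InCalL a zero x = x ≡ 1
InCalL a (suc N) x = (psum a N + 1 ≤ x) × (x ≤ psum a (suc N))

prodBinom : (ℕ → ℕ) → ℕ → ℕ
prodBinom a zero = 1
prodBinom a (suc h) = prodBinom a h * ((a (suc h) + a h ∸ 1) C (a h ∸ 1))

Good : ∀ n → (ℕ → ℕ) → ℕ → Graph n → Set
Good n a h G = IsSimple G × Connected G × Closed G ×
  (∀ (v1 : Fin n) → toℕ v1 ≡ 0 → ∀ N → N ≤ h → ∀ (i : Fin n) →
     (Dist G v1 i N → InCalL a N (suc (toℕ i))) × (InCalL a N (suc (toℕ i)) → Dist G v1 i N))

-- A good graph G is determined by its reach r, where r x − 1 is the largest label among x and its
-- neighbours: for x < y, closedness makes x ~ y equivalent to y < r x. The layer condition forces each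
-- layer to be a clique whose last vertex is adjacent to the whole next layer. Hence on a layer N < h the
-- reach is nondecreasing, r x − 1 lies between the last vertices of layers N and N + 1 (a (N + 1) + 1
-- choices), and at the last vertex of layer N it is the last vertex of layer N + 1; on the top layer r = n.
-- Conversely every such r is the reach of a good graph. So layer N contributes a nondecreasing sequence
-- of a N − 1 free values, counted by (a (N + 1) + a N − 1) C (a N − 1).

module Submission where

open import Defs
open import Data.Bool as Bool using (Bool; true; false)
open import Data.Empty using (⊥-elim)
open import Data.Fin as Fin using (Fin; toℕ; fromℕ<)
open import Data.Fin.Properties using (toℕ-injective; toℕ<n; toℕ-fromℕ<; fromℕ<-toℕ)
open import Data.List using (List; []; _∷_; _++_; map; length; replicate; cartesianProductWith)
open import Data.List.Properties using (length-++; length-map; length-replicate; map-++; ++-cancelʳ; ∷-injective)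
open import Data.List.Membership.Propositional using (_∈_)
open import Data.List.Membership.Propositional.Properties
  using (∈-map⁺; ∈-map⁻; ∈-++⁺ˡ; ∈-++⁺ʳ; ∈-++⁻; ∈-cartesianProductWith⁺; ∈-cartesianProductWith⁻)
open import Data.List.Relation.Unary.Any using (here; there)
open import Data.List.Relation.Unary.All as All using (All)
import Data.List.Relation.Unary.All.Properties as Allₚ
open import Data.List.Relation.Unary.AllPairs using ([]; _∷_)
open import Data.List.Relation.Unary.Unique.Propositional using (Unique)
import Data.List.Relation.Unary.Unique.Propositional.Properties as Uniqueₚ
open import Data.Nat using (ℕ; zero; suc; _+_; _*_; _∸_; _≤_; _<_; z≤n; s≤s; _≤?_; _<?_; s≤s⁻¹)
open import Data.Nat.Properties
open import Data.Nat.Combinatorics using (_C_; nCn≡1; nCk+nC[k+1]≡[n+1]C[k+1])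
open import Data.Product using (Σ; ∃; _×_; _,_; proj₁; proj₂)
open import Data.Sum using (_⊎_; inj₁; inj₂)
open import Data.Vec using (Vec; lookup; tabulate)
open import Data.Vec.Properties using (lookup∘tabulate; tabulate∘lookup; tabulate-cong)
open import Function.Bundles using (_⇔_; mk⇔)
open import Relation.Binary.Definitions using (tri<; tri≈; tri>)
open import Relation.Binary.PropositionalEquality
open import Relation.Nullary using (¬_; Dec; yes; no; does)
open import Relation.Nullary.Decidable using (dec-true; _×-dec_; _⊎-dec_)

data SortedWithin : ℕ → ℕ → List ℕ → Set where
  []   : ∀ {lo hi} → SortedWithin lo hi []
  cons : ∀ {lo hi v l} → lo ≤ v → v ≤ hi → SortedWithin v hi l → SortedWithin lo hi (v ∷ l)

SortedWithin-replicate : ∀ {lo hi} k → lo ≤ hi → SortedWithin lo hi (replicate k lo)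
SortedWithin-replicate zero    lo≤hi = []
SortedWithin-replicate (suc k) lo≤hi = cons ≤-refl lo≤hi (SortedWithin-replicate k lo≤hi)

SortedWithin-weaken : ∀ {lo lo′ hi l} → lo ≤ lo′ → SortedWithin lo′ hi l → SortedWithin lo hi l
SortedWithin-weaken lo≤lo′ []           = []
SortedWithin-weaken lo≤lo′ (cons p q s) = cons (≤-trans lo≤lo′ p) q s

SortedWithin-constant : ∀ {lo l} → SortedWithin lo lo l → l ≡ replicate (length l) lo
SortedWithin-constant []           = refl
SortedWithin-constant (cons p q s) with ≤-antisym p q
... | refl = cong (_ ∷_) (SortedWithin-constant s)

SortedWithin-∷ʳ : ∀ {lo hi l} → SortedWithin lo hi l → lo ≤ hi → SortedWithin lo hi (l ++ hi ∷ [])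
SortedWithin-∷ʳ []           lo≤hi = cons lo≤hi ≤-refl []
SortedWithin-∷ʳ (cons p q s) _     = cons p q (SortedWithin-∷ʳ s q)

sortedLists : (k lo m : ℕ) → List (List ℕ)
sortedLists zero    lo m       = [] ∷ []
sortedLists (suc k) lo zero    = replicate (suc k) lo ∷ []
sortedLists (suc k) lo (suc m) = map (lo ∷_) (sortedLists k lo (suc m)) ++ sortedLists (suc k) (suc lo) m

length-sortedLists : ∀ k lo m → length (sortedLists k lo m) ≡ (m + k) C k
length-sortedLists zero    lo m       = refl
length-sortedLists (suc k) lo zero    = sym (nCn≡1 (suc k))
length-sortedLists (suc k) lo (suc m) = begin
    length (map (lo ∷_) (sortedLists k lo (suc m)) ++ sortedLists (suc k) (suc lo) m)
  ≡⟨ length-++ (map (lo ∷_) (sortedLists k lo (suc m))) ⟩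
    length (map (lo ∷_) (sortedLists k lo (suc m))) + length (sortedLists (suc k) (suc lo) m)
  ≡⟨ cong₂ _+_ (trans (length-map (lo ∷_) (sortedLists k lo (suc m))) (length-sortedLists k lo (suc m)))
               (length-sortedLists (suc k) (suc lo) m) ⟩
    (suc m + k) C k + (m + suc k) C suc k
  ≡⟨ cong (λ z → z C k + (m + suc k) C suc k) (sym (+-suc m k)) ⟩
    (m + suc k) C k + (m + suc k) C suc k
  ≡⟨ nCk+nC[k+1]≡[n+1]C[k+1] (m + suc k) k ⟩
    (suc m + suc k) C suc k ∎
  where open ≡-Reasoning

sortedLists-sound : ∀ k lo m {l} → l ∈ sortedLists k lo m → length l ≡ k × SortedWithin lo (lo + m) l
sortedLists-sound zero    lo m    (here refl) = refl , []
sortedLists-sound (suc k) lo zero (here refl) =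
  length-replicate (suc k) , SortedWithin-replicate (suc k) (m≤m+n lo 0)
sortedLists-sound (suc k) lo (suc m) l∈ with ∈-++⁻ (map (lo ∷_) (sortedLists k lo (suc m))) l∈
... | inj₁ l∈head with ∈-map⁻ (lo ∷_) l∈head
...   | l′ , l′∈ , refl with sortedLists-sound k lo (suc m) l′∈
...     | len , s = cong suc len , cons ≤-refl (m≤m+n lo (suc m)) s
sortedLists-sound (suc k) lo (suc m) {l} l∈ | inj₂ l∈tail with sortedLists-sound (suc k) (suc lo) m l∈tail
... | len , s = len , SortedWithin-weaken (n≤1+n lo) (subst (λ z → SortedWithin (suc lo) z l) (sym (+-suc lo m)) s)

sortedLists-complete : ∀ k lo m l → length l ≡ k → SortedWithin lo (lo + m) l → l ∈ sortedLists k lo m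
sortedLists-complete zero    lo m    [] len s = here refl
sortedLists-complete (suc k) lo zero l  len s = here (begin
    l                             ≡⟨ SortedWithin-constant (subst (λ z → SortedWithin lo z l) (+-identityʳ lo) s) ⟩
    replicate (length l) lo       ≡⟨ cong (λ z → replicate z lo) len ⟩
    replicate (suc k) lo          ∎)
  where open ≡-Reasoning
sortedLists-complete (suc k) lo (suc m) (v ∷ l) len (cons lo≤v v≤hi s) with m≤n⇒m<n∨m≡n lo≤v
... | inj₂ refl = ∈-++⁺ˡ (∈-map⁺ (lo ∷_) (sortedLists-complete k lo (suc m) l (suc-injective len) s))
... | inj₁ lo<v = ∈-++⁺ʳ (map (lo ∷_) (sortedLists k lo (suc m)))
  (sortedLists-complete (suc k) (suc lo) m (v ∷ l) len
    (cons lo<v (subst (v ≤_) (+-suc lo m) v≤hi) (subst (λ z → SortedWithin v z l) (+-suc lo m) s)))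

sortedLists-unique : ∀ k lo m → Unique (sortedLists k lo m)
sortedLists-unique zero    lo m       = All.[] ∷ []
sortedLists-unique (suc k) lo zero    = All.[] ∷ []
sortedLists-unique (suc k) lo (suc m) =
  Uniqueₚ.++⁺ (Uniqueₚ.map⁺ (λ eq → proj₂ (∷-injective eq)) (sortedLists-unique k lo (suc m)))
             (sortedLists-unique (suc k) (suc lo) m) disjoint
  where
  disjoint : ∀ {l} → ¬ (l ∈ map (lo ∷_) (sortedLists k lo (suc m)) × l ∈ sortedLists (suc k) (suc lo) m)
  disjoint (l∈head , l∈tail) with ∈-map⁻ (lo ∷_) l∈head
  ... | _ , _ , refl with sortedLists-sound (suc k) (suc lo) m l∈tail
  ...   | _ , cons lo<lo _ _ = n≮n lo lo<lo

-- Junk value 0 past the end: a list of naturals is read as a function ℕ → ℕ.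
nth : List ℕ → ℕ → ℕ
nth []      _       = 0
nth (x ∷ l) zero    = x
nth (x ∷ l) (suc i) = nth l i

nth-++ˡ : ∀ p q {i} → i < length p → nth (p ++ q) i ≡ nth p i
nth-++ˡ (x ∷ p) q {zero}  _         = refl
nth-++ˡ (x ∷ p) q {suc i} (s≤s i<p) = nth-++ˡ p q i<p

nth-++ʳ : ∀ p q i → nth (p ++ q) (length p + i) ≡ nth q i
nth-++ʳ []      q i = refl
nth-++ʳ (x ∷ p) q i = nth-++ʳ p q i

nth-replicate : ∀ k v {i} → i < k → nth (replicate k v) i ≡ v
nth-replicate (suc k) v {zero}  _         = refl
nth-replicate (suc k) v {suc i} (s≤s i<k) = nth-replicate k v i<k

nth-ext : ∀ p q → length p ≡ length q → (∀ i → i < length p → nth p i ≡ nth q i) → p ≡ q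
nth-ext []      []      _   _  = refl
nth-ext (x ∷ p) (y ∷ q) len eq =
  cong₂ _∷_ (eq zero (s≤s z≤n)) (nth-ext p q (suc-injective len) (λ i i<p → eq (suc i) (s≤s i<p)))

SortedWithin-nth-bounds : ∀ {lo hi l} i → SortedWithin lo hi l → i < length l → lo ≤ nth l i × nth l i ≤ hi
SortedWithin-nth-bounds zero    (cons p q s) _         = p , q
SortedWithin-nth-bounds (suc i) (cons p q s) (s≤s i<l) with SortedWithin-nth-bounds i s i<l
... | lo≤ , ≤hi = ≤-trans p lo≤ , ≤hi

SortedWithin-nth-mono : ∀ {lo hi l} i j → SortedWithin lo hi l → i ≤ j → j < length l → nth l i ≤ nth l j
SortedWithin-nth-mono zero    zero    _            _         _         = ≤-refl
SortedWithin-nth-mono zero    (suc j) (cons p q s) _         (s≤s j<l) = proj₁ (SortedWithin-nth-bounds j s j<l)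
SortedWithin-nth-mono (suc i) (suc j) (cons p q s) (s≤s i≤j) (s≤s j<l) = SortedWithin-nth-mono i j s i≤j j<l

range : ℕ → ℕ → List ℕ
range s zero    = []
range s (suc k) = s ∷ range (suc s) k

length-range : ∀ s k → length (range s k) ≡ k
length-range s zero    = refl
length-range s (suc k) = cong suc (length-range (suc s) k)

range-+ : ∀ s k l → range s (k + l) ≡ range s k ++ range (s + k) l
range-+ s zero    l = cong (λ z → range z l) (sym (+-identityʳ s))
range-+ s (suc k) l =
  cong (s ∷_) (trans (range-+ (suc s) k l) (cong (λ z → range (suc s) k ++ range z l) (sym (+-suc s k))))

nth-map-range : ∀ (f : ℕ → ℕ) s {k i} → i < k → nth (map f (range s k)) i ≡ f (s + i)
nth-map-range f s {suc k} {zero}  _         = cong f (sym (+-identityʳ s))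
nth-map-range f s {suc k} {suc i} (s≤s i<k) = trans (nth-map-range f (suc s) i<k) (cong f (sym (+-suc s i)))

map-range-constant : ∀ (f : ℕ → ℕ) s k v → (∀ x → s ≤ x → x < s + k → f x ≡ v) → map f (range s k) ≡ replicate k v
map-range-constant f s zero    v eq = refl
map-range-constant f s (suc k) v eq =
  cong₂ _∷_ (eq s ≤-refl (subst (s <_) (sym (+-suc s k)) (s≤s (m≤m+n s k))))
            (map-range-constant f (suc s) k v
              (λ x s<x x<s+k → eq x (≤-trans (n≤1+n s) s<x) (subst (x <_) (sym (+-suc s k)) x<s+k)))

SortedWithin-map-range : ∀ (f : ℕ → ℕ) s k lo hi →
  (∀ x → s ≤ x → x < s + k → lo ≤ f x × f x ≤ hi) →
  (∀ x y → s ≤ x → x ≤ y → y < s + k → f x ≤ f y) →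
  SortedWithin lo hi (map f (range s k))
SortedWithin-map-range f s zero    lo hi bounds mono = []
SortedWithin-map-range f s (suc k) lo hi bounds mono =
  cons (proj₁ (bounds s ≤-refl s<)) (proj₂ (bounds s ≤-refl s<))
    (SortedWithin-map-range f (suc s) k (f s) hi
      (λ x s<x x< → mono s x ≤-refl (<⇒≤ s<x) (shift x<) , proj₂ (bounds x (<⇒≤ s<x) (shift x<)))
      (λ x y s<x x≤y y< → mono x y (<⇒≤ s<x) x≤y (shift y<)))
  where
  shift : ∀ {x} → x < suc s + k → x < s + suc k
  shift {x} = subst (x <_) (sym (+-suc s k))
  s< : s < s + suc k
  s< = shift (s≤s (m≤m+n s k))

length-cartesianProductWith : ∀ {A B C : Set} (f : A → B → C) xs ys →
  length (cartesianProductWith f xs ys) ≡ length xs * length ys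
length-cartesianProductWith f []       ys = refl
length-cartesianProductWith f (x ∷ xs) ys = begin
    length (map (f x) ys ++ cartesianProductWith f xs ys)
  ≡⟨ length-++ (map (f x) ys) ⟩
    length (map (f x) ys) + length (cartesianProductWith f xs ys)
  ≡⟨ cong₂ _+_ (length-map (f x) ys) (length-cartesianProductWith f xs ys) ⟩
    length ys + length xs * length ys ∎
  where open ≡-Reasoning

map⁺-injectiveOn : ∀ {A B : Set} (f : A → B) {xs} → Unique xs →
  (∀ {x y} → x ∈ xs → y ∈ xs → f x ≡ f y → x ≡ y) → Unique (map f xs)
map⁺-injectiveOn f {[]}     []           inj = []
map⁺-injectiveOn f {x ∷ xs} (x∉xs ∷ uxs) inj =
  Allₚ.map⁺ (All.tabulate (λ y∈ fx≡fy → All.lookup x∉xs y∈ (inj (here refl) (there y∈) fx≡fy)))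
  ∷ map⁺-injectiveOn f uxs (λ x∈ y∈ → inj (there x∈) (there y∈))

++-injective-sameLength : ∀ {A : Set} (p q : List A) {b b′} → length p ≡ length q → p ++ b ≡ q ++ b′ → p ≡ q × b ≡ b′
++-injective-sameLength []      []      len eq = refl , eq
++-injective-sameLength (x ∷ p) (y ∷ q) len eq with ∷-injective eq
... | refl , eq′ with ++-injective-sameLength p q (suc-injective len) eq′
...   | refl , b≡b′ = refl , b≡b′

cartesianProductWith-++-unique : ∀ {A : Set} k (ps bs : List (List A)) → All (λ p → length p ≡ k) ps →
  Unique ps → Unique bs → Unique (cartesianProductWith _++_ ps bs)
cartesianProductWith-++-unique k []       bs _            _            _   = []
cartesianProductWith-++-unique k (p ∷ ps) bs (lp All.∷ lps) (p∉ps ∷ ups) ubs =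
  Uniqueₚ.++⁺ (Uniqueₚ.map⁺ (λ eq → proj₂ (++-injective-sameLength p p refl eq)) ubs)
             (cartesianProductWith-++-unique k ps bs lps ups ubs) disjoint
  where
  disjoint : ∀ {v} → ¬ (v ∈ map (p ++_) bs × v ∈ cartesianProductWith _++_ ps bs)
  disjoint (v∈head , v∈tail) with ∈-map⁻ (p ++_) v∈head | ∈-cartesianProductWith⁻ _++_ ps bs v∈tail
  ... | b , _ , refl | q , b′ , q∈ , _ , eq =
    All.lookup p∉ps q∈ (proj₁ (++-injective-sameLength p q (trans lp (sym (All.lookup lps q∈))) eq))

module _ {m} {G : Graph m} where

  Walk-∷ʳ : ∀ {i j k l} → Walk G i j l → Adj G j k → Walk G i k (suc l)
  Walk-∷ʳ here        e = step e here
  Walk-∷ʳ (step e′ w) e = step e′ (Walk-∷ʳ w e)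

  Walk-++ : ∀ {i j k l l′} → Walk G i j l → Walk G j k l′ → Walk G i k (l + l′)
  Walk-++ here       w′ = w′
  Walk-++ (step e w) w′ = step e (Walk-++ w w′)

  Walk-reverse : (∀ i j → Adj G i j → Adj G j i) → ∀ {i j l} → Walk G i j l → Walk G j i l
  Walk-reverse sym-adj here       = here
  Walk-reverse sym-adj (step e w) = Walk-∷ʳ (Walk-reverse sym-adj w) (sym-adj _ _ e)

  Walk-unsnoc : ∀ {i k l} → Walk G i k (suc l) → Σ (Fin m) λ j → Walk G i j l × Adj G j k
  Walk-unsnoc (step e here)         = _ , here , e
  Walk-unsnoc (step e (step e′ w)) with Walk-unsnoc (step e′ w)
  ... | j , w′ , e″ = j , step e w′ , e″

  Dist-unique : ∀ {u v N M} → Dist G u v N → Dist G u v M → N ≡ M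
  Dist-unique {N = N} {M} (w , shortest) (w′ , shortest′) with <-cmp N M
  ... | tri< N<M _ _ = ⊥-elim (shortest′ N N<M w)
  ... | tri≈ _ N≡M _ = N≡M
  ... | tri> _ _ M<N = ⊥-elim (shortest M M<N w′)

Graph-ext : ∀ {m} (G G′ : Graph m) →
  (∀ i j → Adj G i j → Adj G′ i j) → (∀ i j → Adj G′ i j → Adj G i j) → G ≡ G′
Graph-ext G G′ to from =
  Vec-ext G G′ (λ i → Vec-ext (lookup G i) (lookup G′ i) (λ j → Bool-ext (to i j) (from i j)))
  where
  Vec-ext : ∀ {A : Set} {k} (v w : Vec A k) → (∀ i → lookup v i ≡ lookup w i) → v ≡ w
  Vec-ext v w eq = trans (sym (tabulate∘lookup v)) (trans (tabulate-cong eq) (tabulate∘lookup w))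
  Bool-ext : ∀ {b b′ : Bool} → (b ≡ true → b′ ≡ true) → (b′ ≡ true → b ≡ true) → b ≡ b′
  Bool-ext {false} {false} _ _ = refl
  Bool-ext {false} {true}  _ g = g refl
  Bool-ext {true}  {false} f _ = sym (f refl)
  Bool-ext {true}  {true}  _ _ = refl

does-true⇒ : ∀ {P : Set} (P? : Dec P) → does P? ≡ true → P
does-true⇒ (yes p) _ = p

Greatest : ∀ {m} → (Fin m → Set) → Set
Greatest {m} P = Σ (Fin m) λ t → P t × (∀ y → P y → toℕ y ≤ toℕ t)

greatest-or-none : ∀ {m} (P : Fin m → Set) → (∀ y → Dec (P y)) → Greatest P ⊎ (∀ y → ¬ P y)
greatest-or-none {zero}  P P? = inj₂ (λ ())
greatest-or-none {suc m} P P? with greatest-or-none (λ y → P (Fin.suc y)) (λ y → P? (Fin.suc y))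
... | inj₁ (t , Pt , max) = inj₁ (Fin.suc t , Pt , max′)
  where
  max′ : ∀ y → P y → toℕ y ≤ toℕ (Fin.suc t)
  max′ Fin.zero    _  = z≤n
  max′ (Fin.suc y) Py = s≤s (max y Py)
... | inj₂ none with P? Fin.zero
...   | yes P0 = inj₁ (Fin.zero , P0 , max′)
  where
  max′ : ∀ y → P y → toℕ y ≤ 0
  max′ Fin.zero    _  = z≤n
  max′ (Fin.suc y) Py = ⊥-elim (none y Py)
...   | no ¬P0 = inj₂ none′
  where
  none′ : ∀ y → ¬ P y
  none′ Fin.zero    = ¬P0
  none′ (Fin.suc y) = none y

greatest : ∀ {m} (P : Fin m → Set) → (∀ y → Dec (P y)) → ∀ w → P w → Greatest P
greatest P P? w Pw with greatest-or-none P P?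
... | inj₁ g    = g
... | inj₂ none = ⊥-elim (none w Pw)

module Layered (a : ℕ → ℕ) (h : ℕ) (a₀≡1 : a 0 ≡ 1) (a-pos : ∀ N → 1 ≤ N → N ≤ h → 1 ≤ a N) where

  n : ℕ
  n = psum a h

  -- Labels are shifted down by one (vertex 1 has label 0), so layer N is [start N, start (suc N)).
  start : ℕ → ℕ
  start zero    = 0
  start (suc N) = psum a N

  start-suc : ∀ N → start (suc N) ≡ start N + a N
  start-suc zero    = refl
  start-suc (suc N) = refl

  layerSize-pos : ∀ N → N ≤ h → 1 ≤ a N
  layerSize-pos zero    _   = ≤-reflexive (sym a₀≡1)
  layerSize-pos (suc N) N≤h = a-pos (suc N) (s≤s z≤n) N≤h

  start-≤-suc : ∀ N → start N ≤ start (suc N)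
  start-≤-suc N = subst (start N ≤_) (sym (start-suc N)) (m≤m+n (start N) (a N))

  start-mono : ∀ N M → N ≤ M → start N ≤ start M
  start-mono zero    M       _   = z≤n
  start-mono (suc N) (suc M) N≤M with m≤n⇒m<n∨m≡n N≤M
  ... | inj₂ refl      = ≤-refl
  ... | inj₁ (s≤s N<M) = ≤-trans (start-mono (suc N) M N<M) (start-≤-suc M)

  InLayer : ℕ → ℕ → Set
  InLayer N x = start N ≤ x × x < start (suc N)

  InLayer-mono : ∀ {N M x y} → InLayer N x → InLayer M y → x ≤ y → N ≤ M
  InLayer-mono {N} {M} (N≤x , _) (_ , y<) x≤y with N ≤? M
  ... | yes N≤M = N≤M
  ... | no  N≰M =
    ⊥-elim (<-irrefl refl (≤-trans y< (≤-trans (start-mono (suc M) N (≰⇒> N≰M)) (≤-trans N≤x x≤y))))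

  InLayer-unique : ∀ {N M x} → InLayer N x → InLayer M x → N ≡ M
  InLayer-unique p q = ≤-antisym (InLayer-mono p q ≤-refl) (InLayer-mono q p ≤-refl)

  InLayer-< : ∀ {M y K} → InLayer M y → y < start K → M < K
  InLayer-< {M} {y} {K} (M≤y , _) y<K with M <? K
  ... | yes M<K = M<K
  ... | no  M≮K = ⊥-elim (<-irrefl refl (<-≤-trans y<K (≤-trans (start-mono K M (≮⇒≥ M≮K)) M≤y)))

  layerBelow : ∀ K x → x < start K → ∃ λ N → N < K × InLayer N x
  layerBelow (suc K) x x< with x <? start K
  ... | no  x≮ = K , ≤-refl , ≮⇒≥ x≮ , x<
  ... | yes x<′ with layerBelow K x x<′
  ...   | N , N<K , inN = N , m<n⇒m<1+n N<K , inN

  layerOf : ∀ x → x < n → Σ ℕ λ N → N ≤ h × InLayer N x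
  layerOf x x<n with layerBelow (suc h) x x<n
  ... | N , N<1+h , inN = N , s≤s⁻¹ N<1+h , inN

  InLayer-≤h : ∀ {N x} → InLayer N x → x < n → N ≤ h
  InLayer-≤h {x = x} inN x<n with layerOf x x<n
  ... | M , M≤h , inM = subst (_≤ h) (InLayer-unique inM inN) M≤h

  InLayer-0 : ∀ {x} → InLayer 0 x → x ≡ 0
  InLayer-0 (_ , x<a₀) = n<1⇒n≡0 (subst (_ <_) a₀≡1 x<a₀)

  lastOfLayer-InLayer : ∀ N l → N ≤ h → suc l ≡ start (suc N) → InLayer N l
  lastOfLayer-InLayer N l N≤h eq =
    s≤s⁻¹ (subst (_≤ suc l) (+-comm (start N) 1)
      (subst (start N + 1 ≤_) (sym (trans eq (start-suc N))) (+-monoʳ-≤ (start N) (layerSize-pos N N≤h)))) ,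
    ≤-reflexive eq

  lastOfLayer : ∀ N → N ≤ h → Σ ℕ λ l → InLayer N l × suc l ≡ start (suc N)
  lastOfLayer N N≤h = l , lastOfLayer-InLayer N l N≤h eq , eq
    where
    l = start N + (a N ∸ 1)
    eq : suc l ≡ start (suc N)
    eq = trans (sym (+-suc (start N) (a N ∸ 1)))
               (trans (cong (start N +_) (m+[n∸m]≡n (layerSize-pos N N≤h))) (sym (start-suc N)))

  InCalL⇒InLayer : ∀ N x → InCalL a N (suc x) → InLayer N x
  InCalL⇒InLayer zero    x refl      = z≤n , subst (0 <_) (sym a₀≡1) (s≤s z≤n)
  InCalL⇒InLayer (suc N) x (lo , hi) = s≤s⁻¹ (subst (_≤ suc x) (+-comm (psum a N) 1) lo) , hi

  InLayer⇒InCalL : ∀ N x → InLayer N x → InCalL a N (suc x)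
  InLayer⇒InCalL zero    x inN       = cong suc (InLayer-0 inN)
  InLayer⇒InCalL (suc N) x (lo , hi) = subst (_≤ suc x) (+-comm 1 (psum a N)) (s≤s lo) , hi

  n-pos : 0 < n
  n-pos = <-≤-trans (subst (0 <_) (sym a₀≡1) (s≤s z≤n)) (start-mono 1 (suc h) (s≤s z≤n))

  ReachAdj : (ℕ → ℕ) → ℕ → ℕ → Set
  ReachAdj r x y = (x < y × y < r x) ⊎ (y < x × x < r y)

  ReachAdj? : ∀ r x y → Dec (ReachAdj r x y)
  ReachAdj? r x y = ((x <? y) ×-dec (y <? r x)) ⊎-dec ((y <? x) ×-dec (x <? r y))

  record IsReachBelow (K : ℕ) (r : ℕ → ℕ) : Set where
    field
      mono   : ∀ x y → x ≤ y → y < start K → r x ≤ r y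
      bounds : ∀ M x → M < K → InLayer M x → start (suc M) ≤ r x × r x ≤ start (suc (suc M))
      last   : ∀ M x → M < K → suc x ≡ start (suc M) → start (suc (suc M)) ≤ r x

  IsReach : (ℕ → ℕ) → Set
  IsReach r = IsReachBelow h r × (∀ x → InLayer h x → r x ≡ n)

  IsReachBelow-cong : ∀ {K r r′} → IsReachBelow K r → (∀ x → x < start K → r x ≡ r′ x) → IsReachBelow K r′
  IsReachBelow-cong {K} {r} {r′} isR eq = record
    { mono   = λ x y x≤y y< → subst₂ _≤_ (eq x (≤-<-trans x≤y y<)) (eq y y<) (mono x y x≤y y<)
    ; bounds = λ M x M<K inM → subst (λ z → start (suc M) ≤ z × z ≤ start (suc (suc M)))
                                     (eq x (<-≤-trans (proj₂ inM) (start-mono (suc M) K M<K))) (bounds M x M<K inM)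
    ; last   = λ M x M<K e → subst (start (suc (suc M)) ≤_)
                                   (eq x (≤-trans (≤-reflexive e) (start-mono (suc M) K M<K))) (last M x M<K e)
    }
    where open IsReachBelow isR

  IsReachBelow-pred : ∀ {K r} → IsReachBelow (suc K) r → IsReachBelow K r
  IsReachBelow-pred {K} isR = record
    { mono   = λ x y x≤y y< → mono x y x≤y (<-≤-trans y< (start-≤-suc K))
    ; bounds = λ M x M<K → bounds M x (m<n⇒m<1+n M<K)
    ; last   = λ M x M<K → last M x (m<n⇒m<1+n M<K)
    }
    where open IsReachBelow isR

  -- A reach function is coded by its list of values on [0, n).
  layerCodes : ℕ → List (List ℕ)
  layerCodes N = map (λ l → l ++ start (suc (suc N)) ∷ []) (sortedLists (a N ∸ 1) (start (suc N)) (a (suc N)))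

  prefixCodes : ℕ → List (List ℕ)
  prefixCodes zero    = [] ∷ []
  prefixCodes (suc K) = cartesianProductWith _++_ (prefixCodes K) (layerCodes K)

  codes : List (List ℕ)
  codes = map (_++ replicate (a h) n) (prefixCodes h)

  layerCodes-sound : ∀ N {b} → N < h → b ∈ layerCodes N →
    length b ≡ a N × SortedWithin (start (suc N)) (start (suc (suc N))) b × nth b (a N ∸ 1) ≡ start (suc (suc N))
  layerCodes-sound N N<h b∈ with ∈-map⁻ (λ l → l ++ start (suc (suc N)) ∷ []) b∈
  ... | l , l∈ , refl with sortedLists-sound (a N ∸ 1) (start (suc N)) (a (suc N)) l∈
  ...   | len , sorted = len′ , SortedWithin-∷ʳ sorted (m≤m+n (start (suc N)) (a (suc N))) , last
    where
    hi = start (suc (suc N))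
    len′ : length (l ++ hi ∷ []) ≡ a N
    len′ = trans (length-++ l) (trans (+-comm (length l) 1)
                 (trans (cong suc len) (m+[n∸m]≡n (layerSize-pos N (<⇒≤ N<h)))))
    last : nth (l ++ hi ∷ []) (a N ∸ 1) ≡ hi
    last = subst (λ i → nth (l ++ hi ∷ []) i ≡ hi) (trans (+-identityʳ (length l)) len) (nth-++ʳ l (hi ∷ []) 0)

  module Extend {K q b} (a-pos-K : 1 ≤ a K) (len-q : length q ≡ start K) (reach-q : IsReachBelow K (nth q))
                (len-b : length b ≡ a K) (sorted-b : SortedWithin (start (suc K)) (start (suc (suc K))) b)
                (last-b : nth b (a K ∸ 1) ≡ start (suc (suc K))) where

    open IsReachBelow reach-q
    s = start K
    r = nth (q ++ b)

    start-suc-K : start (suc K) ≡ s + length b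
    start-suc-K = trans (start-suc K) (cong (s +_) (sym len-b))

    length-q++b : length (q ++ b) ≡ start (suc K)
    length-q++b = trans (length-++ q) (trans (cong (_+ length b) len-q) (sym start-suc-K))

    r-left : ∀ {x} → x < s → r x ≡ nth q x
    r-left x<s = nth-++ˡ q b (subst (_ <_) (sym len-q) x<s)

    r-right : ∀ {x} → s ≤ x → r x ≡ nth b (x ∸ s)
    r-right {x} s≤x =
      trans (cong r (sym (trans (cong (_+ (x ∸ s)) len-q) (m+[n∸m]≡n s≤x)))) (nth-++ʳ q b (x ∸ s))

    index-b : ∀ {x} → s ≤ x → x < start (suc K) → x ∸ s < length b
    index-b {x} s≤x x< = subst (x ∸ s <_) (m+n∸m≡n s (length b)) (∸-monoˡ-< (subst (x <_) start-suc-K x<) s≤x)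

    q-below : ∀ {x} → x < s → nth q x ≤ start (suc K)
    q-below {x} x<s with layerBelow K x x<s
    ... | M , M<K , inM = ≤-trans (proj₂ (bounds M x M<K inM)) (start-mono (suc (suc M)) (suc K) (s≤s M<K))

    mono′ : ∀ x y → x ≤ y → y < start (suc K) → r x ≤ r y
    mono′ x y x≤y y< with y <? s | x <? s
    ... | yes y<s | _ = subst₂ _≤_ (sym (r-left (≤-<-trans x≤y y<s))) (sym (r-left y<s)) (mono x y x≤y y<s)
    ... | no y≮s | yes x<s = subst₂ _≤_ (sym (r-left x<s)) (sym (r-right (≮⇒≥ y≮s)))
      (≤-trans (q-below x<s) (proj₁ (SortedWithin-nth-bounds (y ∸ s) sorted-b (index-b (≮⇒≥ y≮s) y<))))
    ... | no y≮s | no x≮s = subst₂ _≤_ (sym (r-right (≮⇒≥ x≮s))) (sym (r-right (≮⇒≥ y≮s)))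
      (SortedWithin-nth-mono (x ∸ s) (y ∸ s) sorted-b (∸-monoˡ-≤ s x≤y) (index-b (≮⇒≥ y≮s) y<))

    bounds′ : ∀ M x → M < suc K → InLayer M x → start (suc M) ≤ r x × r x ≤ start (suc (suc M))
    bounds′ M x M<1+K inM with m≤n⇒m<n∨m≡n (s≤s⁻¹ M<1+K)
    ... | inj₁ M<K = subst (λ z → start (suc M) ≤ z × z ≤ start (suc (suc M)))
                           (sym (r-left (<-≤-trans (proj₂ inM) (start-mono (suc M) K M<K)))) (bounds M x M<K inM)
    ... | inj₂ refl = subst (λ z → start (suc M) ≤ z × z ≤ start (suc (suc M))) (sym (r-right (proj₁ inM)))
                            (SortedWithin-nth-bounds (x ∸ s) sorted-b (index-b (proj₁ inM) (proj₂ inM)))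

    last′ : ∀ M x → M < suc K → suc x ≡ start (suc M) → start (suc (suc M)) ≤ r x
    last′ M x M<1+K e with m≤n⇒m<n∨m≡n (s≤s⁻¹ M<1+K)
    ... | inj₁ M<K = subst (start (suc (suc M)) ≤_)
                           (sym (r-left (≤-trans (≤-reflexive e) (start-mono (suc M) K M<K)))) (last M x M<K e)
    ... | inj₂ refl = ≤-reflexive (sym (trans (cong r x≡) (trans (nth-++ʳ q b (a K ∸ 1)) last-b)))
      where
      x≡ : x ≡ length q + (a K ∸ 1)
      x≡ = suc-injective (begin
        suc x                       ≡⟨ trans e (start-suc K) ⟩
        start K + a K               ≡⟨ cong₂ _+_ (sym len-q) (sym (m+[n∸m]≡n a-pos-K)) ⟩
        length q + suc (a K ∸ 1)    ≡⟨ +-suc (length q) (a K ∸ 1) ⟩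
        suc (length q + (a K ∸ 1))  ∎)
        where open ≡-Reasoning

    isReachBelow : IsReachBelow (suc K) r
    isReachBelow = record { mono = mono′ ; bounds = bounds′ ; last = last′ }

  prefixCodes-sound : ∀ K → K ≤ h → ∀ {p} → p ∈ prefixCodes K → length p ≡ start K × IsReachBelow K (nth p)
  prefixCodes-sound zero    _   (here refl) = refl , record
    { mono = λ { _ _ _ () } ; bounds = λ { _ _ () _ } ; last = λ { _ _ () _ } }
  prefixCodes-sound (suc K) K<h p∈ with ∈-cartesianProductWith⁻ _++_ (prefixCodes K) (layerCodes K) p∈
  ... | q , b , q∈ , b∈ , refl with prefixCodes-sound K (<⇒≤ K<h) q∈ | layerCodes-sound K K<h b∈
  ...   | len-q , reach-q | len-b , sorted-b , last-b = length-q++b , isReachBelow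
    where open Extend {K} {q} {b} (layerSize-pos K (<⇒≤ K<h)) len-q reach-q len-b sorted-b last-b

  codes-sound : ∀ {c} → c ∈ codes → length c ≡ n × IsReach (nth c)
  codes-sound c∈ with ∈-map⁻ (_++ replicate (a h) n) c∈
  ... | p , p∈ , refl with prefixCodes-sound h ≤-refl p∈
  ...   | len-p , reach-p =
    len , IsReachBelow-cong reach-p (λ x x< → sym (nth-++ˡ p top (subst (x <_) (sym len-p) x<))) , on-top
    where
    top = replicate (a h) n
    len : length (p ++ top) ≡ n
    len = trans (length-++ p) (trans (cong₂ _+_ len-p (length-replicate (a h))) (sym (start-suc h)))
    on-top : ∀ x → InLayer h x → nth (p ++ top) x ≡ n
    on-top x (lo , hi) = trans (cong (nth (p ++ top)) (sym x≡)) (trans (nth-++ʳ p top (x ∸ start h))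
        (nth-replicate (a h) n (subst (x ∸ start h <_) (m+n∸m≡n (start h) (a h))
                                  (∸-monoˡ-< (subst (x <_) (start-suc h) hi) lo))))
      where
      x≡ : length p + (x ∸ start h) ≡ x
      x≡ = trans (cong (_+ (x ∸ start h)) len-p) (m+[n∸m]≡n lo)

  map-range-start-suc : ∀ (r : ℕ → ℕ) K →
    map r (range 0 (start (suc K))) ≡ map r (range 0 (start K)) ++ map r (range (start K) (a K))
  map-range-start-suc r K = begin
    map r (range 0 (start (suc K)))                              ≡⟨ cong (λ z → map r (range 0 z)) (start-suc K) ⟩
    map r (range 0 (start K + a K))                              ≡⟨ cong (map r) (range-+ 0 (start K) (a K)) ⟩
    map r (range 0 (start K) ++ range (start K) (a K))           ≡⟨ map-++ r (range 0 (start K)) (range (start K) (a K)) ⟩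
    map r (range 0 (start K)) ++ map r (range (start K) (a K))   ∎
    where open ≡-Reasoning

  layerCodes-complete : ∀ K → K < h → ∀ r → IsReachBelow (suc K) r → map r (range (start K) (a K)) ∈ layerCodes K
  layerCodes-complete K K<h r isR =
    subst (_∈ layerCodes K) (sym split) (∈-map⁺ (λ l → l ++ hi ∷ []) front∈)
    where
    open IsReachBelow isR
    s = start K
    k = a K ∸ 1
    hi = start (suc (suc K))
    a≡ : a K ≡ k + 1
    a≡ = sym (m∸n+n≡m (layerSize-pos K (<⇒≤ K<h)))
    start-suc-K : start (suc K) ≡ s + (k + 1)
    start-suc-K = trans (start-suc K) (cong (s +_) a≡)
    inK : ∀ x → s ≤ x → x < s + k → InLayer K x
    inK x s≤x x< = s≤x , subst (x <_) (sym start-suc-K) (≤-trans x< (+-monoʳ-≤ s (m≤m+n k 1)))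
    last≡ : suc (s + k) ≡ start (suc K)
    last≡ = trans (cong suc (sym (+-identityʳ (s + k))))
              (trans (sym (+-suc (s + k) 0)) (trans (+-assoc s k 1) (sym start-suc-K)))
    r-last : r (s + k) ≡ hi
    r-last = ≤-antisym (proj₂ (bounds K (s + k) ≤-refl (m≤m+n s k , ≤-reflexive last≡))) (last K (s + k) ≤-refl last≡)
    split : map r (range s (a K)) ≡ map r (range s k) ++ hi ∷ []
    split = trans (cong (λ z → map r (range s z)) a≡)
           (trans (cong (map r) (range-+ s k 1))
           (trans (map-++ r (range s k) (range (s + k) 1)) (cong (λ z → map r (range s k) ++ z ∷ []) r-last)))
    front∈ : map r (range s k) ∈ sortedLists k (start (suc K)) (a (suc K))
    front∈ = sortedLists-complete k (start (suc K)) (a (suc K)) (map r (range s k))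
      (trans (length-map r (range s k)) (length-range s k))
      (SortedWithin-map-range r s k (start (suc K)) hi (λ x s≤x x< → bounds K x ≤-refl (inK x s≤x x<))
        (λ x y s≤x x≤y y< → mono x y x≤y (proj₂ (inK y (≤-trans s≤x x≤y) y<))))

  prefixCodes-complete : ∀ K → K ≤ h → ∀ r → IsReachBelow K r → map r (range 0 (start K)) ∈ prefixCodes K
  prefixCodes-complete zero    _   r isR = here refl
  prefixCodes-complete (suc K) K<h r isR = subst (_∈ prefixCodes (suc K)) (sym (map-range-start-suc r K))
    (∈-cartesianProductWith⁺ _++_ (prefixCodes-complete K (<⇒≤ K<h) r (IsReachBelow-pred isR))
                                  (layerCodes-complete K K<h r isR))

  codes-complete : ∀ r → IsReach r → map r (range 0 n) ∈ codes
  codes-complete r (isR , on-top) =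
    subst (_∈ codes) (sym split) (∈-map⁺ (_++ replicate (a h) n) (prefixCodes-complete h ≤-refl r isR))
    where
    split : map r (range 0 n) ≡ map r (range 0 (start h)) ++ replicate (a h) n
    split = trans (map-range-start-suc r h) (cong (map r (range 0 (start h)) ++_)
      (map-range-constant r (start h) (a h) n (λ x lo hi → on-top x (lo , subst (x <_) (sym (start-suc h)) hi))))

  length-prefixCodes : ∀ K → K ≤ h → length (prefixCodes K) ≡ prodBinom a K
  length-prefixCodes zero    _   = refl
  length-prefixCodes (suc K) K<h = begin
    length (cartesianProductWith _++_ (prefixCodes K) (layerCodes K))
      ≡⟨ length-cartesianProductWith _++_ (prefixCodes K) (layerCodes K) ⟩
    length (prefixCodes K) * length (layerCodes K)
      ≡⟨ cong₂ _*_ (length-prefixCodes K (<⇒≤ K<h))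
                   (length-map _ (sortedLists (a K ∸ 1) (start (suc K)) (a (suc K)))) ⟩
    prodBinom a K * length (sortedLists (a K ∸ 1) (start (suc K)) (a (suc K)))
      ≡⟨ cong (prodBinom a K *_) (length-sortedLists (a K ∸ 1) (start (suc K)) (a (suc K))) ⟩
    prodBinom a K * ((a (suc K) + (a K ∸ 1)) C (a K ∸ 1))
      ≡⟨ cong (λ z → prodBinom a K * (z C (a K ∸ 1))) (sym (+-∸-assoc (a (suc K)) (layerSize-pos K (<⇒≤ K<h)))) ⟩
    prodBinom a (suc K) ∎
    where open ≡-Reasoning

  prefixCodes-unique : ∀ K → K ≤ h → Unique (prefixCodes K)
  prefixCodes-unique zero    _   = All.[] ∷ []
  prefixCodes-unique (suc K) K<h = cartesianProductWith-++-unique (start K) (prefixCodes K) (layerCodes K)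
    (All.tabulate (λ p∈ → proj₁ (prefixCodes-sound K (<⇒≤ K<h) p∈)))
    (prefixCodes-unique K (<⇒≤ K<h))
    (Uniqueₚ.map⁺ (λ {x} {y} → ++-cancelʳ _ x y) (sortedLists-unique (a K ∸ 1) (start (suc K)) (a (suc K))))

  codes-unique : Unique codes
  codes-unique = Uniqueₚ.map⁺ (λ {x} {y} → ++-cancelʳ _ x y) (prefixCodes-unique h ≤-refl)

  length-codes : length codes ≡ prodBinom a h
  length-codes = trans (length-map _ (prefixCodes h)) (length-prefixCodes h ≤-refl)

  reachGraph : (ℕ → ℕ) → Graph n
  reachGraph r = tabulate λ i → tabulate λ j → does (ReachAdj? r (toℕ i) (toℕ j))

  Adj-reachGraph⁻ : ∀ r i j → Adj (reachGraph r) i j → ReachAdj r (toℕ i) (toℕ j)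
  Adj-reachGraph⁻ r i j e = does-true⇒ (ReachAdj? r (toℕ i) (toℕ j))
    (trans (sym (trans (cong (λ row → lookup row j) (lookup∘tabulate _ i)) (lookup∘tabulate _ j))) e)

  Adj-reachGraph⁺ : ∀ r i j → ReachAdj r (toℕ i) (toℕ j) → Adj (reachGraph r) i j
  Adj-reachGraph⁺ r i j adj = trans (trans (cong (λ row → lookup row j) (lookup∘tabulate _ i)) (lookup∘tabulate _ j))
    (dec-true (ReachAdj? r (toℕ i) (toℕ j)) adj)

  module ReachGraph (r : ℕ → ℕ) (isReach : IsReach r) where

    open IsReachBelow (proj₁ isReach)
    on-top = proj₂ isReach
    G = reachGraph r

    reach-lower : ∀ N x → N ≤ h → InLayer N x → start (suc N) ≤ r x
    reach-lower N x N≤h inN with m≤n⇒m<n∨m≡n N≤h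
    ... | inj₁ N<h  = proj₁ (bounds N x N<h inN)
    ... | inj₂ refl = ≤-reflexive (sym (on-top x inN))

    reach-≤n : ∀ x → x < n → r x ≤ n
    reach-≤n x x<n with layerOf x x<n
    ... | N , N≤h , inN with m≤n⇒m<n∨m≡n N≤h
    ...   | inj₁ N<h  = ≤-trans (proj₂ (bounds N x N<h inN)) (start-mono (suc (suc N)) (suc h) (s≤s N<h))
    ...   | inj₂ refl = ≤-reflexive (on-top x inN)

    reach-> : ∀ x → x < n → x < r x
    reach-> x x<n with layerOf x x<n
    ... | N , N≤h , inN = <-≤-trans (proj₂ inN) (reach-lower N x N≤h inN)

    reach-mono : ∀ x y → x ≤ y → y < n → r x ≤ r y
    reach-mono x y x≤y y<n with y <? start h
    ... | yes y< = mono x y x≤y y<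
    ... | no  y≮ = subst (r x ≤_) (sym (on-top y (≮⇒≥ y≮ , y<n))) (reach-≤n x (≤-<-trans x≤y y<n))

    ReachAdj-layer : ∀ x y N M → x < n → ReachAdj r x y → InLayer N x → InLayer M y → M ≤ suc N
    ReachAdj-layer x y N M x<n (inj₁ (x<y , y<r)) inN inM with N <? h
    ... | yes N<h = s≤s⁻¹ (InLayer-< inM (<-≤-trans y<r (proj₂ (bounds N x N<h inN))))
    ... | no  N≮h = ≤-trans (InLayer-≤h inM (<-≤-trans y<r (reach-≤n x x<n))) (≤-trans (≮⇒≥ N≮h) (n≤1+n N))
    ReachAdj-layer x y N M x<n (inj₂ (y<x , _)) inN inM = ≤-trans (InLayer-mono inM inN (<⇒≤ y<x)) (n≤1+n N)

    irreflexive : ∀ i → ¬ Adj G i i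
    irreflexive i e with Adj-reachGraph⁻ r i i e
    ... | inj₁ (i<i , _) = <-irrefl refl i<i
    ... | inj₂ (i<i , _) = <-irrefl refl i<i

    symmetric : ∀ i j → Adj G i j → Adj G j i
    symmetric i j e with Adj-reachGraph⁻ r i j e
    ... | inj₁ adj = Adj-reachGraph⁺ r j i (inj₂ adj)
    ... | inj₂ adj = Adj-reachGraph⁺ r j i (inj₁ adj)

    walk-layer : ∀ {u w m N M} → Walk G u w m → InLayer N (toℕ u) → InLayer M (toℕ w) → M ≤ N + m
    walk-layer {N = N} here inN inM = ≤-reflexive (trans (InLayer-unique inM inN) (sym (+-identityʳ N)))
    walk-layer {u} {m = suc m} {N} (step {j = j} e w) inN inM with layerOf (toℕ j) (toℕ<n j)
    ... | N′ , _ , inN′ = ≤-trans (walk-layer w inN′ inM)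
      (≤-trans (+-monoˡ-≤ m (ReachAdj-layer (toℕ u) (toℕ j) N N′ (toℕ<n u) (Adj-reachGraph⁻ r u j e) inN inN′))
               (≤-reflexive (sym (+-suc N m))))

    -- Each vertex of layer N + 1 is reached from the last vertex of layer N.
    walk-from-0 : ∀ N → N ≤ h → ∀ (v₀ : Fin n) → toℕ v₀ ≡ 0 → ∀ y → InLayer N (toℕ y) → Walk G v₀ y N
    walk-from-0 zero    _   v₀ v₀≡0 y inN =
      subst (λ z → Walk G v₀ z 0) (toℕ-injective (trans v₀≡0 (sym (InLayer-0 inN)))) here
    walk-from-0 (suc N) N<h v₀ v₀≡0 y inN with lastOfLayer N (<⇒≤ N<h)
    ... | l , inl , l-last = Walk-∷ʳ (walk-from-0 N (<⇒≤ N<h) v₀ v₀≡0 lF inlF) (Adj-reachGraph⁺ r lF y adj)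
      where
      l<n : l < n
      l<n = <-≤-trans (proj₂ inl) (start-mono (suc N) (suc h) (s≤s (<⇒≤ N<h)))
      lF = fromℕ< l<n
      lF≡ : toℕ lF ≡ l
      lF≡ = toℕ-fromℕ< l<n
      inlF : InLayer N (toℕ lF)
      inlF = subst (InLayer N) (sym lF≡) inl
      adj : ReachAdj r (toℕ lF) (toℕ y)
      adj = inj₁ (subst (_< toℕ y) (sym lF≡) (subst (_≤ toℕ y) (sym l-last) (proj₁ inN)) ,
                  subst (λ z → toℕ y < r z) (sym lF≡) (<-≤-trans (proj₂ inN) (last N l N<h l-last)))

    dist-from-0 : ∀ N → N ≤ h → ∀ (v₀ : Fin n) → toℕ v₀ ≡ 0 → ∀ y → InLayer N (toℕ y) → Dist G v₀ y N
    dist-from-0 N N≤h v₀ v₀≡0 y inN = walk-from-0 N N≤h v₀ v₀≡0 y inN ,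
      λ m m<N w → <-irrefl refl
        (<-≤-trans m<N (walk-layer w (subst (InLayer 0) (sym v₀≡0) (InCalL⇒InLayer 0 0 refl)) inN))

    layers : ∀ (v₀ : Fin n) → toℕ v₀ ≡ 0 → ∀ N → N ≤ h → ∀ (i : Fin n) →
      (Dist G v₀ i N → InCalL a N (suc (toℕ i))) × (InCalL a N (suc (toℕ i)) → Dist G v₀ i N)
    layers v₀ v₀≡0 N N≤h i = to , λ inN → dist-from-0 N N≤h v₀ v₀≡0 i (InCalL⇒InLayer N _ inN)
      where
      to : Dist G v₀ i N → InCalL a N (suc (toℕ i))
      to d with layerOf (toℕ i) (toℕ<n i)
      ... | M , M≤h , inM = InLayer⇒InCalL N _
        (subst (λ z → InLayer z (toℕ i)) (Dist-unique (dist-from-0 M M≤h v₀ v₀≡0 i inM) d) inM)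

    connected : Connected G
    connected i j with layerOf (toℕ i) (toℕ<n i) | layerOf (toℕ j) (toℕ<n j)
    ... | Ni , Ni≤h , ini | Nj , Nj≤h , inj =
      Ni + Nj , Walk-++ (Walk-reverse symmetric (walk-from-0 Ni Ni≤h v₀ v₀≡0 i ini))
                        (walk-from-0 Nj Nj≤h v₀ v₀≡0 j inj)
      where
      v₀ = fromℕ< n-pos
      v₀≡0 = toℕ-fromℕ< n-pos

    closed : Closed G
    closed i j k eji eik j≢k cases =
      Adj-reachGraph⁺ r j k (go (Adj-reachGraph⁻ r j i eji) (Adj-reachGraph⁻ r i k eik) cases)
      where
      x = toℕ i
      y = toℕ j
      z = toℕ k
      y≢z : y ≢ z
      y≢z y≡z = j≢k (toℕ-injective y≡z)
      go : ReachAdj r y x → ReachAdj r x z → (x < y × x < z) ⊎ (y < x × z < x) → ReachAdj r y z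
      go (inj₁ (y<x , _)) _ (inj₁ (x<y , _)) = ⊥-elim (<-asym x<y y<x)
      go (inj₂ _) (inj₂ (z<x , _)) (inj₁ (_ , x<z)) = ⊥-elim (<-asym x<z z<x)
      go (inj₂ (x<y , y<rx)) (inj₁ (x<z , z<rx)) (inj₁ _) with <-cmp y z
      ... | tri< y<z _ _ = inj₁ (y<z , <-≤-trans z<rx (reach-mono x y (<⇒≤ x<y) (toℕ<n j)))
      ... | tri≈ _ y≡z _ = ⊥-elim (y≢z y≡z)
      ... | tri> _ _ z<y = inj₂ (z<y , <-≤-trans y<rx (reach-mono x z (<⇒≤ x<z) (toℕ<n k)))
      go (inj₂ (x<y , _)) _ (inj₂ (y<x , _)) = ⊥-elim (<-asym x<y y<x)
      go (inj₁ _) (inj₁ (x<z , _)) (inj₂ (_ , z<x)) = ⊥-elim (<-asym x<z z<x)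
      go (inj₁ (y<x , x<ry)) (inj₂ (z<x , x<rz)) (inj₂ _) with <-cmp y z
      ... | tri< y<z _ _ = inj₁ (y<z , <-trans z<x x<ry)
      ... | tri≈ _ y≡z _ = ⊥-elim (y≢z y≡z)
      ... | tri> _ _ z<y = inj₂ (z<y , <-trans y<x x<rz)

    good : Good n a h G
    good = (irreflexive , symmetric) , connected , closed , layers

  reachGraph-≮ : ∀ r r′ → IsReach r → IsReach r′ → reachGraph r ≡ reachGraph r′ → ∀ x → x < n → ¬ r x < r′ x
  reachGraph-≮ r r′ isR isR′ eq x x<n rx<r′x with adj
    where
    y<n : r x < n
    y<n = <-≤-trans rx<r′x (ReachGraph.reach-≤n r′ isR′ x x<n)
    xF = fromℕ< x<n
    yF = fromℕ< y<n
    adj′ : Adj (reachGraph r′) xF yF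
    adj′ = Adj-reachGraph⁺ r′ xF yF (subst₂ (ReachAdj r′) (sym (toℕ-fromℕ< x<n)) (sym (toℕ-fromℕ< y<n))
                                         (inj₁ (ReachGraph.reach-> r isR x x<n , rx<r′x)))
    adj : ReachAdj r x (r x)
    adj = subst₂ (ReachAdj r) (toℕ-fromℕ< x<n) (toℕ-fromℕ< y<n)
                 (Adj-reachGraph⁻ r xF yF (subst (λ g → Adj g xF yF) (sym eq) adj′))
  ... | inj₁ (_ , rx<rx) = <-irrefl refl rx<rx
  ... | inj₂ (rx<x , _)  = <-asym rx<x (ReachGraph.reach-> r isR x x<n)

  reachGraph-injective : ∀ r r′ → IsReach r → IsReach r′ → reachGraph r ≡ reachGraph r′ → ∀ x → x < n → r x ≡ r′ x
  reachGraph-injective r r′ isR isR′ eq x x<n with <-cmp (r x) (r′ x)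
  ... | tri< lt _ _ = ⊥-elim (reachGraph-≮ r r′ isR isR′ eq x x<n lt)
  ... | tri≈ _ eq′ _ = eq′
  ... | tri> _ _ gt = ⊥-elim (reachGraph-≮ r′ r isR′ isR (sym eq) x x<n gt)

  reachGraph-cong : ∀ r r′ → (∀ x → x < n → r x ≡ r′ x) → reachGraph r ≡ reachGraph r′
  reachGraph-cong r r′ eq = Graph-ext (reachGraph r) (reachGraph r′)
    (transport r r′ eq) (transport r′ r (λ x x<n → sym (eq x x<n)))
    where
    transport : ∀ r r′ → (∀ x → x < n → r x ≡ r′ x) → ∀ i j → Adj (reachGraph r) i j → Adj (reachGraph r′) i j
    transport r r′ eq i j e with Adj-reachGraph⁻ r i j e
    ... | inj₁ (i<j , j<r) = Adj-reachGraph⁺ r′ i j (inj₁ (i<j , subst (toℕ j <_) (eq _ (toℕ<n i)) j<r))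
    ... | inj₂ (j<i , i<r) = Adj-reachGraph⁺ r′ i j (inj₂ (j<i , subst (toℕ i <_) (eq _ (toℕ<n j)) i<r))

  module GoodGraph (G : Graph n) (good : Good n a h G) where

    irreflexive : ∀ i → ¬ Adj G i i
    irreflexive = proj₁ (proj₁ good)

    symmetric : ∀ i j → Adj G i j → Adj G j i
    symmetric = proj₂ (proj₁ good)

    closed : Closed G
    closed = proj₁ (proj₂ (proj₂ good))

    v₀ : Fin n
    v₀ = fromℕ< n-pos

    dist : ∀ (y : Fin n) N → InLayer N (toℕ y) → Dist G v₀ y N
    dist y N inN = proj₂ (proj₂ (proj₂ (proj₂ good)) v₀ (toℕ-fromℕ< n-pos) N (InLayer-≤h inN (toℕ<n y)) y)
                         (InLayer⇒InCalL N _ inN)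

    walk-length : ∀ {w m M} → Walk G v₀ w m → InLayer M (toℕ w) → M ≤ m
    walk-length {w} {m} {M} wk inM = ≮⇒≥ (λ m<M → proj₂ (dist w M inM) m m<M wk)

    Adj-layer : ∀ {u w N M} → Adj G u w → InLayer N (toℕ u) → InLayer M (toℕ w) → M ≤ suc N
    Adj-layer {u} {N = N} e inu inw = walk-length (Walk-∷ʳ (proj₁ (dist u N inu)) e) inw

    predecessor : ∀ M (w : Fin n) → InLayer (suc M) (toℕ w) → Σ (Fin n) λ p → InLayer M (toℕ p) × Adj G p w
    predecessor M w inw with Walk-unsnoc (proj₁ (dist w (suc M) inw))
    ... | p , wp , e with layerOf (toℕ p) (toℕ<n p)
    ...   | K , _ , inK = p , subst (λ z → InLayer z (toℕ p)) K≡M inK , e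
      where
      K≡M : K ≡ M
      K≡M = ≤-antisym (walk-length {M = K} wp inK) (s≤s⁻¹ (Adj-layer {N = K} e inK inw))

    ≢-toℕ : ∀ {u w : Fin n} → toℕ u ≢ toℕ w → u ≢ w
    ≢-toℕ ne refl = ne refl

    -- Closedness at the last vertex l of layer N joins any two vertices of layer N + 1, both being
    -- adjacent to l; and a vertex of layer N + 1 is adjacent to l by closedness at its predecessor.
    mutual
      layer-clique : ∀ N → N ≤ h → ∀ (u w : Fin n) → InLayer N (toℕ u) → InLayer N (toℕ w) → u ≢ w → Adj G u w
      layer-clique zero    _   u w inu inw u≢w =
        ⊥-elim (u≢w (toℕ-injective (trans (InLayer-0 inu) (sym (InLayer-0 inw)))))
      layer-clique (suc N) N<h u w inu inw u≢w with lastOfLayer N (<⇒≤ N<h)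
      ... | l , inl , l-last = closed lF u w (symmetric lF u (last-adj-next N N<h lF u lF-last inu))
                                 (last-adj-next N N<h lF w lF-last inw) u≢w (inj₁ (lF< u inu , lF< w inw))
        where
        l<n : l < n
        l<n = <-≤-trans (proj₂ inl) (start-mono (suc N) (suc h) (s≤s (<⇒≤ N<h)))
        lF = fromℕ< l<n
        lF-last : suc (toℕ lF) ≡ start (suc N)
        lF-last = trans (cong suc (toℕ-fromℕ< l<n)) l-last
        lF< : ∀ (v : Fin n) → InLayer (suc N) (toℕ v) → toℕ lF < toℕ v
        lF< v inv = subst (_≤ toℕ v) (sym lF-last) (proj₁ inv)

      last-adj-next : ∀ N → N < h → ∀ (l w : Fin n) → suc (toℕ l) ≡ start (suc N) → InLayer (suc N) (toℕ w) → Adj G l w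
      last-adj-next N N<h l w l-last inw with predecessor N w inw
      ... | p , inp , p~w with p Fin.≟ l
      ...   | yes refl = p~w
      ...   | no  p≢l  = closed p l w (symmetric p l (layer-clique N (<⇒≤ N<h) p l inp inl p≢l)) p~w l≢w
                           (inj₁ (p<l , <-trans p<l l<w))
        where
        inl : InLayer N (toℕ l)
        inl = lastOfLayer-InLayer N (toℕ l) (<⇒≤ N<h) l-last
        l<w : toℕ l < toℕ w
        l<w = subst (_≤ toℕ w) (sym l-last) (proj₁ inw)
        l≢w : l ≢ w
        l≢w = ≢-toℕ (<⇒≢ l<w)
        p<l : toℕ p < toℕ l
        p<l = ≤∧≢⇒< (s≤s⁻¹ (subst (suc (toℕ p) ≤_) (sym l-last) (proj₂ inp))) (λ eq → p≢l (toℕ-injective eq))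

    layerOfFin : ∀ (u : Fin n) → Σ ℕ λ N → N ≤ h × InLayer N (toℕ u)
    layerOfFin u = layerOf (toℕ u) (toℕ<n u)

    Adj-interval : ∀ (u y z : Fin n) → toℕ u < toℕ y → toℕ y < toℕ z → Adj G u z → Adj G u y
    Adj-interval u y z u<y y<z u~z with layerOfFin u | layerOfFin y | layerOfFin z
    ... | Nu , _ , inu | Ny , Ny≤h , iny | Nz , _ , inz with Ny ≟ Nu
    ...   | yes refl = layer-clique Ny Ny≤h u y inu iny (≢-toℕ (<⇒≢ u<y))
    ...   | no  Ny≢Nu = closed z u y u~z (symmetric y z (layer-clique Ny Ny≤h y z iny inz′ (≢-toℕ (<⇒≢ y<z))))
                          (≢-toℕ (<⇒≢ u<y)) (inj₂ (<-trans u<y y<z , y<z))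
      where
      Nu≤Ny : Nu ≤ Ny
      Nu≤Ny = InLayer-mono inu iny (<⇒≤ u<y)
      Ny≤Nz : Ny ≤ Nz
      Ny≤Nz = InLayer-mono iny inz (<⇒≤ y<z)
      Nz≤1+Nu : Nz ≤ suc Nu
      Nz≤1+Nu = Adj-layer u~z inu inz
      Ny≡1+Nu : Ny ≡ suc Nu
      Ny≡1+Nu = ≤-antisym (≤-trans Ny≤Nz Nz≤1+Nu) (≤∧≢⇒< Nu≤Ny (λ eq → Ny≢Nu (sym eq)))
      inz′ : InLayer Ny (toℕ z)
      inz′ = subst (λ N → InLayer N (toℕ z))
                   (≤-antisym (≤-trans Nz≤1+Nu (≤-reflexive (sym Ny≡1+Nu))) Ny≤Nz) inz

    SelfOrNeighbour : Fin n → Fin n → Set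
    SelfOrNeighbour u y = y ≡ u ⊎ Adj G u y

    farthest : ∀ u → Greatest (SelfOrNeighbour u)
    farthest u = greatest (SelfOrNeighbour u)
      (λ y → (y Fin.≟ u) ⊎-dec (lookup (lookup G u) y Bool.≟ true)) u (inj₁ refl)

    far : Fin n → Fin n
    far u = proj₁ (farthest u)

    far-SelfOrNeighbour : ∀ u → SelfOrNeighbour u (far u)
    far-SelfOrNeighbour u = proj₁ (proj₂ (farthest u))

    far-max : ∀ u y → SelfOrNeighbour u y → toℕ y ≤ toℕ (far u)
    far-max u = proj₂ (proj₂ (farthest u))

    reachFin : Fin n → ℕ
    reachFin u = suc (toℕ (far u))

    reach : ℕ → ℕ
    reach x with x <? n
    ... | yes x<n = reachFin (fromℕ< x<n)
    ... | no  _   = 0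

    reach-toℕ : ∀ (u : Fin n) → reach (toℕ u) ≡ reachFin u
    reach-toℕ u with toℕ u <? n
    ... | yes u<n = cong reachFin (fromℕ<-toℕ u u<n)
    ... | no  u≮n = ⊥-elim (u≮n (toℕ<n u))

    reach-fromℕ< : ∀ x (x<n : x < n) → reach x ≡ reachFin (fromℕ< x<n)
    reach-fromℕ< x x<n = trans (cong reach (sym (toℕ-fromℕ< x<n))) (reach-toℕ _)

    Adj⇒ReachAdj : ∀ i j → Adj G i j → ReachAdj reach (toℕ i) (toℕ j)
    Adj⇒ReachAdj i j i~j with <-cmp (toℕ i) (toℕ j)
    ... | tri< i<j _ _ = inj₁ (i<j , subst (toℕ j <_) (sym (reach-toℕ i)) (s≤s (far-max i j (inj₂ i~j))))
    ... | tri≈ _ i≡j _ = ⊥-elim (irreflexive i (subst (Adj G i) (sym (toℕ-injective i≡j)) i~j))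
    ... | tri> _ _ j<i =
      inj₂ (j<i , subst (toℕ i <_) (sym (reach-toℕ j)) (s≤s (far-max j i (inj₂ (symmetric i j i~j)))))

    below-far⇒Adj : ∀ i j → toℕ i < toℕ j → toℕ j < reachFin i → Adj G i j
    below-far⇒Adj i j i<j j<r with far-SelfOrNeighbour i
    ... | inj₁ far≡i =
      ⊥-elim (<-irrefl refl (<-≤-trans i<j (subst (λ z → toℕ j ≤ toℕ z) far≡i (s≤s⁻¹ j<r))))
    ... | inj₂ i~far with m≤n⇒m<n∨m≡n (s≤s⁻¹ j<r)
    ...   | inj₁ j<far = Adj-interval i j (far i) i<j j<far i~far
    ...   | inj₂ j≡far = subst (Adj G i) (sym (toℕ-injective j≡far)) i~far

    ReachAdj⇒Adj : ∀ i j → ReachAdj reach (toℕ i) (toℕ j) → Adj G i j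
    ReachAdj⇒Adj i j (inj₁ (i<j , j<r)) = below-far⇒Adj i j i<j (subst (toℕ j <_) (reach-toℕ i) j<r)
    ReachAdj⇒Adj i j (inj₂ (j<i , i<r)) = symmetric j i (below-far⇒Adj j i j<i (subst (toℕ i <_) (reach-toℕ j) i<r))

    G≡reachGraph : G ≡ reachGraph reach
    G≡reachGraph = Graph-ext G (reachGraph reach)
      (λ i j i~j → Adj-reachGraph⁺ reach i j (Adj⇒ReachAdj i j i~j))
      (λ i j i~j → ReachAdj⇒Adj i j (Adj-reachGraph⁻ reach i j i~j))

    reachFin-mono : ∀ (u w : Fin n) → toℕ u ≤ toℕ w → reachFin u ≤ reachFin w
    reachFin-mono u w u≤w with toℕ (far u) ≤? toℕ w
    ... | yes far≤w = s≤s (≤-trans far≤w (far-max w w (inj₁ refl)))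
    ... | no  far≰w with m≤n⇒m<n∨m≡n u≤w
    ...   | inj₂ u≡w = ≤-reflexive (cong reachFin (toℕ-injective u≡w))
    ...   | inj₁ u<w with far-SelfOrNeighbour u
    ...     | inj₁ far≡u = ⊥-elim (far≰w (subst (λ z → toℕ z ≤ toℕ w) (sym far≡u) u≤w))
    ...     | inj₂ u~far = s≤s (far-max w (far u) (inj₂ (closed u w (far u) (symmetric u w u~w) u~far
                              (≢-toℕ (<⇒≢ w<far)) (inj₁ (u<w , <-trans u<w w<far)))))
      where
      w<far : toℕ w < toℕ (far u)
      w<far = ≰⇒> far≰w
      u~w : Adj G u w
      u~w = Adj-interval u w (far u) u<w w<far u~far

    toFin : ∀ l → l < n → Σ (Fin n) λ f → toℕ f ≡ l
    toFin l l<n = fromℕ< l<n , toℕ-fromℕ< l<n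

    reachFin-lower : ∀ M → M ≤ h → ∀ (u : Fin n) → InLayer M (toℕ u) → start (suc M) ≤ reachFin u
    reachFin-lower M M≤h u inu with lastOfLayer M M≤h
    ... | l , inl , l-last with toFin l (<-≤-trans (proj₂ inl) (start-mono (suc M) (suc h) (s≤s M≤h)))
    ...   | lF , lF≡ = subst (_≤ reachFin u) (trans (cong suc lF≡) l-last) (s≤s (far-max u lF self-or-adj))
      where
      self-or-adj : SelfOrNeighbour u lF
      self-or-adj with lF Fin.≟ u
      ... | yes lF≡u = inj₁ lF≡u
      ... | no  lF≢u =
        inj₂ (layer-clique M M≤h u lF inu (subst (InLayer M) (sym lF≡) inl) (λ eq → lF≢u (sym eq)))

    reachFin-upper : ∀ M → M < h → ∀ (u : Fin n) → InLayer M (toℕ u) → reachFin u ≤ start (suc (suc M))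
    reachFin-upper M M<h u inu with far-SelfOrNeighbour u
    ... | inj₁ far≡u =
      ≤-trans (subst (λ z → suc (toℕ z) ≤ start (suc M)) (sym far≡u) (proj₂ inu)) (start-≤-suc (suc M))
    ... | inj₂ u~far with layerOfFin (far u)
    ...   | K , _ , inK = ≤-trans (proj₂ inK) (start-mono (suc K) (suc (suc M)) (s≤s (Adj-layer u~far inu inK)))

    reachFin-last : ∀ M → M < h → ∀ (u : Fin n) → suc (toℕ u) ≡ start (suc M) → start (suc (suc M)) ≤ reachFin u
    reachFin-last M M<h u u-last with lastOfLayer (suc M) M<h
    ... | z , inz , z-last with toFin z (<-≤-trans (proj₂ inz) (start-mono (suc (suc M)) (suc h) (s≤s M<h)))
    ...   | zF , zF≡ = subst (_≤ reachFin u) (trans (cong suc zF≡) z-last)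
      (s≤s (far-max u zF (inj₂ (last-adj-next M M<h u zF u-last (subst (InLayer (suc M)) (sym zF≡) inz)))))

    isReach : IsReach reach
    isReach = record { mono = mono ; bounds = bounds ; last = last } , on-top
      where
      mono : ∀ x y → x ≤ y → y < start h → reach x ≤ reach y
      mono x y x≤y y< = subst₂ _≤_ (sym (reach-fromℕ< x x<n)) (sym (reach-fromℕ< y y<n))
          (reachFin-mono _ _ (subst₂ _≤_ (sym (toℕ-fromℕ< x<n)) (sym (toℕ-fromℕ< y<n)) x≤y))
        where
        y<n = <-≤-trans y< (start-mono h (suc h) (n≤1+n h))
        x<n = ≤-<-trans x≤y y<n
      bounds : ∀ M x → M < h → InLayer M x → start (suc M) ≤ reach x × reach x ≤ start (suc (suc M))
      bounds M x M<h inM = subst (λ z → start (suc M) ≤ z × z ≤ start (suc (suc M))) (sym (reach-fromℕ< x x<n))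
          (reachFin-lower M (<⇒≤ M<h) _ inM′ , reachFin-upper M M<h _ inM′)
        where
        x<n = <-≤-trans (proj₂ inM) (start-mono (suc M) (suc h) (s≤s (<⇒≤ M<h)))
        inM′ = subst (InLayer M) (sym (toℕ-fromℕ< x<n)) inM
      last : ∀ M x → M < h → suc x ≡ start (suc M) → start (suc (suc M)) ≤ reach x
      last M x M<h x-last = subst (start (suc (suc M)) ≤_) (sym (reach-fromℕ< x x<n))
          (reachFin-last M M<h _ (trans (cong suc (toℕ-fromℕ< x<n)) x-last))
        where
        x<n = ≤-trans (≤-reflexive x-last) (start-mono (suc M) (suc h) (s≤s (<⇒≤ M<h)))
      on-top : ∀ x → InLayer h x → reach x ≡ n
      on-top x inh = trans (reach-fromℕ< x (proj₂ inh))
        (≤-antisym (toℕ<n (far _))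
                   (reachFin-lower h ≤-refl _ (subst (InLayer h) (sym (toℕ-fromℕ< (proj₂ inh))) inh)))

  goodGraphs : List (Graph n)
  goodGraphs = map (λ c → reachGraph (nth c)) codes

  goodGraphs-unique : Unique goodGraphs
  goodGraphs-unique = map⁺-injectiveOn (λ c → reachGraph (nth c)) codes-unique injective
    where
    injective : ∀ {c c′} → c ∈ codes → c′ ∈ codes → reachGraph (nth c) ≡ reachGraph (nth c′) → c ≡ c′
    injective {c} {c′} c∈ c′∈ eq with codes-sound c∈ | codes-sound c′∈
    ... | len , isR | len′ , isR′ = nth-ext c c′ (trans len (sym len′))
          (λ x x< → reachGraph-injective (nth c) (nth c′) isR isR′ eq x (subst (x <_) len x<))

  ∈-goodGraphs⇔Good : ∀ G → (G ∈ goodGraphs) ⇔ Good n a h G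
  ∈-goodGraphs⇔Good G = mk⇔ to from
    where
    to : G ∈ goodGraphs → Good n a h G
    to G∈ with ∈-map⁻ (λ c → reachGraph (nth c)) G∈
    ... | c , c∈ , refl = ReachGraph.good (nth c) (proj₂ (codes-sound c∈))
    from : Good n a h G → G ∈ goodGraphs
    from good = subst (_∈ goodGraphs) (sym G≡) (∈-map⁺ (λ c → reachGraph (nth c)) (codes-complete reach isReach))
      where
      open GoodGraph G good using (reach; isReach; G≡reachGraph)
      G≡ : G ≡ reachGraph (nth (map reach (range 0 n)))
      G≡ = trans G≡reachGraph (reachGraph-cong reach _ (λ x x<n → sym (nth-map-range reach 0 x<n)))

  length-goodGraphs : length goodGraphs ≡ prodBinom a h
  length-goodGraphs = trans (length-map _ codes) length-codes

theorem5p4 : (n h : ℕ) (a : ℕ → ℕ) → a 0 ≡ 1 → (∀ N → 1 ≤ N → N ≤ h → 1 ≤ a N) → psum a h ≡ n →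
    Σ (List (Graph n)) λ Gs → Unique Gs × (∀ G → (G ∈ Gs) ⇔ Good n a h G) × (length Gs ≡ prodBinom a h)
theorem5p4 .(psum a h) h a a₀≡1 a-pos refl = goodGraphs , goodGraphs-unique , ∈-goodGraphs⇔Good , length-goodGraphs
  where open Layered a h a₀≡1 a-pos
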